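{- Let $\mathcal{P}\subseteq\mathcal{F}$ be a finite set of feasible paths, and let $\mathtt{OPT}_{\mathcal{P}}=\min\{\|\mathbf{y}\|:\mathbf{y}\in\mathbb{Z}_{\ge0}^E,\ \mathbf{y}\le\mathtt{b},\ \mathtt{D}(\mathcal{P},\mathbf{y})=|\mathcal{P}|\mathtt{T}\}$. The Adaptive Trading algorithm (AT) — start with $\mathbf{x}=\mathbf{0}$; while $\mathtt{D}(\mathcal{P},\mathbf{x})<|\mathcal{P}|\mathtt{T}$: for each edge $e$ with $x_e<b_e$ let $z_e\in\{1,\dots,b_e-x_e\}$ maximize $\frac{\mathtt{D}(\mathcal{P},\mathbf{x}+\mathbf{u}(e,z))-\mathtt{D}(\mathcal{P},\mathbf{x})}{z}$, then choose the edge $e$ maximizing this ratio at $z=z_e$ and set $\mathbf{x}\leftarrow\mathbf{x}+\mathbf{u}(e,z_e)$ — returns a vector $\mathbf{x}$ blocking all paths of $\mathcal{P}$ with $$\|\mathbf{x}\| = O\big(\mathtt{h}\ln n+\ln\mathtt{T}\big)\cdot\mathtt{OPT}_{\mathcal{P}},$$ i.e. within a factor $O(\mathtt{h}\ln n+\ln\mathtt{T})$ of the optimal solution for blocking all paths in $\mathcal{P}$.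
   Context: Let $G=(V,E)$ be a directed graph with $n$ vertices. Each edge $e$ has a monotonically increasing weight function $f_e:\mathbb{Z}_{\ge0}\to\mathbb{Z}_{>0}$; $\mathtt{w}=\min_e f_e(0)>0$. A box $\mathtt{b}\in\mathbb{Z}_{\ge0}^E$, a set $S$ of vertex pairs $(s_i,t_i)$ and an integer threshold $\mathtt{T}$ are given; $\mathtt{h}=\lceil\mathtt{T}/\mathtt{w}\rceil$. Budget vectors are $\mathbf{x}\in\mathbb{Z}_{\ge0}^E$, $\|\mathbf{x}\|=\sum_e x_e$, compared componentwise; $\mathbf{u}(e,z)$ denotes the vector with entry $z$ at edge $e$ and $0$ elsewhere. A feasible path is a single (vertex-simple) directed path from $s_i$ to $t_i$ for some $(s_i,t_i)\in S$ with $\sum_{e\in p}f_e(0)<\mathtt{T}$; $\mathcal{F}$ is the set of feasible paths. For a path $p$, $\mathtt{r}(p,\mathbf{x})=\min(\mathtt{T},\sum_{e\in p}f_e(x_e))$ and $\mathtt{D}(\mathcal{P},\mathbf{x})=\sum_{p\in\mathcal{P}}\mathtt{r}(p,\mathbf{x})$; $\mathbf{x}$ blocks all paths of $\mathcal{P}$ iff $\mathtt{D}(\mathcal{P},\mathbf{x})=|\mathcal{P}|\mathtt{T}$. The $O(\cdot)$ hides an absolute constant. -}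

module Defs where

open import Data.Nat using (ℕ; zero; suc; _+_; _*_; _∸_; _≤_; _<_; _⊓_)
open import Data.Nat.DivMod using (_/_)
open import Data.Fin using (Fin; _≟_) renaming (zero to fzero; suc to fsuc)
open import Data.Bool using (if_then_else_)
open import Data.List using (List; []; _∷_; map; length; allFin)
open import Data.Nat.ListAction using (sum)
open import Data.List.Membership.Propositional using (_∈_)
open import Data.List.Relation.Unary.Unique.Propositional using (Unique)
open import Data.Product using (Σ; ∃; ∃-syntax; _×_; _,_; proj₁; proj₂)
open import Relation.Nullary.Decidable using (⌊_⌋)
open import Relation.Binary.PropositionalEquality using (_≡_)

-- Graph: vertices Fin n, edges Fin m, edge e goes from src e to tgt e.
-- A path is represented by its list of edges (in order).

IsWalk : {n m : ℕ} → (src tgt : Fin m → Fin n) → Fin n → Fin n → List (Fin m) → Set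
IsWalk src tgt s t []       = s ≡ t
IsWalk src tgt s t (e ∷ es) = src e ≡ s × IsWalk src tgt (tgt e) t es

walkVertices : {n m : ℕ} → (tgt : Fin m → Fin n) → Fin n → List (Fin m) → List (Fin n)
walkVertices tgt s es = s ∷ map tgt es

IsPath : {n m : ℕ} → (src tgt : Fin m → Fin n) → Fin n → Fin n → List (Fin m) → Set
IsPath src tgt s t es = IsWalk src tgt s t es × Unique (walkVertices tgt s es)

Budget : ℕ → Set
Budget m = Fin m → ℕ

Weights : ℕ → Set
Weights m = Fin m → ℕ → ℕ

pathWeight : {m : ℕ} → Weights m → Budget m → List (Fin m) → ℕ
pathWeight f x p = sum (map (λ e → f e (x e)) p)

𝟎 : {m : ℕ} → Budget m
𝟎 _ = 0

Feasible : {n m : ℕ} → (src tgt : Fin m → Fin n) → List (Fin n × Fin n) →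
           Weights m → ℕ → List (Fin m) → Set
Feasible src tgt S f T p =
  (∃[ st ] (st ∈ S × IsPath src tgt (proj₁ st) (proj₂ st) p)) × pathWeight f 𝟎 p < T

r : {m : ℕ} → ℕ → Weights m → Budget m → List (Fin m) → ℕ
r T f x p = T ⊓ pathWeight f x p

D : {m : ℕ} → ℕ → Weights m → List (List (Fin m)) → Budget m → ℕ
D T f P x = sum (map (r T f x) P)

Blocks : {m : ℕ} → ℕ → Weights m → List (List (Fin m)) → Budget m → Set
Blocks T f P x = D T f P x ≡ length P * T

norm : {m : ℕ} → Budget m → ℕ
norm {m} x = sum (map x (allFin m))

_≤ᵛ_ : {m : ℕ} → Budget m → Budget m → Set
x ≤ᵛ y = ∀ e → x e ≤ y e

u : {m : ℕ} → Fin m → ℕ → Budget m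
u e z e' = if ⌊ e' ≟ e ⌋ then z else 0

_⊕_ : {m : ℕ} → Budget m → Budget m → Budget m
(x ⊕ y) e = x e + y e

gain : {m : ℕ} → ℕ → Weights m → List (List (Fin m)) → Budget m → Fin m → ℕ → ℕ
gain T f P x e z = D T f P (x ⊕ u e z) ∸ D T f P x

-- w = min_e f_e(0)  (junk value 0 when there are no edges)
minOver : (m : ℕ) → (Fin m → ℕ) → ℕ
minOver zero          g = 0
minOver (suc zero)    g = g fzero
minOver (suc (suc m)) g = g fzero ⊓ minOver (suc m) (λ i → g (fsuc i))

wOf : {m : ℕ} → Weights m → ℕ
wOf {m} f = minOver m (λ e → f e 0)

-- ⌈ a / b ⌉  (junk value 0 for b = 0)
ceilDiv : ℕ → ℕ → ℕ
ceilDiv a zero    = 0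
ceilDiv a (suc k) = (a + k) / suc k

hOf : {m : ℕ} → ℕ → Weights m → ℕ
hOf T f = ceilDiv T (wOf f)

-- The Adaptive Trading algorithm (AT), as a nondeterministic transition
-- system (ties may be broken arbitrarily).
-- Ratios a/z ≤ a'/z' (z,z' ≥ 1) are compared as a * z' ≤ a' * z.

module AT {m : ℕ} (T : ℕ) (f : Weights m) (P : List (List (Fin m))) (b : Budget m) where

  ZSel : Budget m → Set
  ZSel x = (e : Fin m) → x e < b e → ℕ

  ValidZSel : (x : Budget m) → ZSel x → Set
  ValidZSel x zs = (e : Fin m) (lt : x e < b e) →
      1 ≤ zs e lt × zs e lt ≤ b e ∸ x e ×
      ((z : ℕ) → 1 ≤ z → z ≤ b e ∸ x e →
         gain T f P x e z * zs e lt ≤ gain T f P x e (zs e lt) * z)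

  Step : Budget m → Budget m → Set
  Step x x' =
    Σ (ZSel x) λ zs → ValidZSel x zs ×
    Σ (Fin m) λ e → Σ (x e < b e) λ lt →
      ((e' : Fin m) (lt' : x e' < b e') →
         gain T f P x e' (zs e' lt') * zs e lt ≤ gain T f P x e (zs e lt) * zs e' lt') ×
      ((i : Fin m) → x' i ≡ (x ⊕ u e (zs e lt)) i)

  data Run : Budget m → Budget m → Set where
    done : ∀ {x} → Blocks T f P x → Run x x
    step : ∀ {x x' y} → D T f P x < length P * T → Step x x' → Run x' y → Run x y

module Submission where

-- The proof is the greedy set-cover
-- argument for the potential Δ(x) = |P|·T − D(P,x), the deficit.
--   * Key inequality (Objective.Deficit): for any blocking y, the deficit at
--     x is covered by the gains of the single-edge raises of x towards y;
--     this is diminishing returns of the cap t ↦ T ⊓ t (cap-submodular-∑).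
--   * Since AT picks the best gain-per-cost ratio, each step pays at most
--     ‖y‖/Δ(x) per unit of gain (Analysis.greedy-ratio), so a run is a
--     GreedyTrace, and a doubling argument bounds its total cost by 2‖y‖·B
--     whenever Δ(0) < 2^B (greedy-cost).  The same ratio bound with y = b
--     shows that every step makes progress, so AT terminates (run-from).
--   * Counting: feasible paths have < h edges and there are ≤ n² edges, so
--     |P|·T ≤ 2^(3⌈log₂ n⌉h + ⌈log₂ T⌉) (instance-size); this gives B.

open import Defs
open import Data.Nat using (ℕ; zero; suc; _+_; _*_; _∸_; _^_; _≤_; _<_; _⊓_; z≤n; s≤s; s≤s⁻¹; _≤?_; _<?_; ⌊_/2⌋; ⌈_/2⌉)
open import Data.Nat.Properties hiding (_≟_)
open import Data.Nat.DivMod using (_/_; _%_; m≡m%n+[m/n]*n; m%n<n)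
open import Data.Fin using (Fin; _≟_; combine) renaming (zero to fzero; suc to fsuc)
open import Data.List using (List; []; _∷_; map; length; tabulate; lookup)
open import Data.List.Membership.Propositional.Properties using (∈-lookup)
open import Data.List.Relation.Unary.AllPairs using (_∷_)
open import Data.List.Relation.Unary.Unique.Propositional using (Unique)
open import Data.Nat.Logarithm using (⌈log₂_⌉; ⌈log₂⌉-mono-≤; ⌈log₂⌈n/2⌉⌉≡⌈log₂n⌉∸1)
open import Data.Nat.Induction using (<-rec)
open import Data.Fin.Properties using (combine-injective; combine-injectiveˡ; combine-injectiveʳ; injective⇒≤)
open import Data.List.Properties using (map-tabulate)
open import Data.Unit using (tt)
open import Data.Nat.ListAction using (sum)
open import Data.List.Relation.Unary.All as All using (All; []; _∷_)
open import Data.Product using (Σ; ∃-syntax; _×_; _,_; proj₁; proj₂)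
open import Data.Sum using (_⊎_; inj₁; inj₂)
open import Function using (_∘_; id)
open import Relation.Nullary using (¬_; Dec; yes; no; contradiction)
open import Relation.Binary.PropositionalEquality
open import Algebra.Properties.Semiring.Sum +-*-semiring
  using (sum-cong-≗; ∑-distrib-+; *-distribˡ-sum; sum-replicate-zero) renaming (sum to ∑)
open import Data.Nat.Tactic.RingSolver using (solve-∀)

∑-mono : ∀ {k} {g h : Fin k → ℕ} → (∀ i → g i ≤ h i) → ∑ g ≤ ∑ h
∑-mono {zero}  _  = z≤n
∑-mono {suc k} le = +-mono-≤ (le fzero) (∑-mono (le ∘ fsuc))

∑-pointwise : ∀ {k} (v : Fin k → ℕ) (i : Fin k) c → (∀ j → j ≢ i → v j ≡ c) →
              ∑ v + c ≡ v i + ∑ {k} (λ _ → c)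
∑-pointwise {suc k} v fzero c off = begin
  v fzero + ∑ (v ∘ fsuc) + c           ≡⟨ cong (λ s → v fzero + s + c) (sum-cong-≗ (λ j → off (fsuc j) λ ())) ⟩
  v fzero + ∑ {k} (λ _ → c) + c        ≡⟨ shuffle (v fzero) (∑ {k} (λ _ → c)) c ⟩
  v fzero + (c + ∑ {k} (λ _ → c))      ∎
  where
  open ≡-Reasoning
  shuffle : ∀ a s c → a + s + c ≡ a + (c + s)
  shuffle = solve-∀
∑-pointwise {suc k} v (fsuc i) c off = begin
  v fzero + ∑ (v ∘ fsuc) + c           ≡⟨ +-assoc (v fzero) _ c ⟩
  v fzero + (∑ (v ∘ fsuc) + c)         ≡⟨ cong₂ _+_ (off fzero λ ()) (∑-pointwise (v ∘ fsuc) i c (λ j j≢i → off (fsuc j) (j≢i ∘ suc-inj))) ⟩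
  c + (v (fsuc i) + ∑ {k} (λ _ → c))   ≡⟨ shuffle c (v (fsuc i)) _ ⟩
  v (fsuc i) + (c + ∑ {k} (λ _ → c))   ∎
  where
  open ≡-Reasoning
  suc-inj : ∀ {a b : Fin k} → fsuc a ≡ fsuc b → a ≡ b
  suc-inj refl = refl
  shuffle : ∀ a b s → a + (b + s) ≡ b + (a + s)
  shuffle = solve-∀

u-self : ∀ {m} (e : Fin m) z → u e z e ≡ z
u-self e z with e ≟ e
... | yes _  = refl
... | no e≢e = contradiction refl e≢e

u-other : ∀ {m} {e e' : Fin m} z → e' ≢ e → u e z e' ≡ 0
u-other {e = e} {e'} z e'≢e with e' ≟ e
... | yes e'≡e = contradiction e'≡e e'≢e
... | no _     = refl

∑-u : ∀ {m} (e : Fin m) z → ∑ (u e z) ≡ z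
∑-u {m} e z = +-cancelʳ-≡ 0 _ _ (begin
  ∑ (u e z) + 0            ≡⟨ ∑-pointwise (u e z) e 0 (λ _ → u-other z) ⟩
  u e z e + ∑ {m} (λ _ → 0) ≡⟨ cong₂ _+_ (u-self e z) (sum-replicate-zero m) ⟩
  z + 0                    ∎)
  where open ≡-Reasoning

norm≡∑ : ∀ {m} (x : Budget m) → norm x ≡ ∑ x
norm≡∑ {m} x = trans (cong sum (map-tabulate id x)) (sum-tabulate x)
  where
  sum-tabulate : ∀ {k} (g : Fin k → ℕ) → sum (tabulate g) ≡ ∑ g
  sum-tabulate {zero}  g = refl
  sum-tabulate {suc k} g = cong (g fzero +_) (sum-tabulate (g ∘ fsuc))

sumMap-+ : ∀ {A : Set} (L : List A) (g h : A → ℕ) →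
           sum (map (λ a → g a + h a) L) ≡ sum (map g L) + sum (map h L)
sumMap-+ []      g h = refl
sumMap-+ (a ∷ L) g h = trans (cong (g a + h a +_) (sumMap-+ L g h)) (+-shuffle (g a) (h a) _ _)
  where
  +-shuffle : ∀ a b c d → a + b + (c + d) ≡ a + c + (b + d)
  +-shuffle = solve-∀

sumMap-cong : ∀ {A : Set} (L : List A) {g h : A → ℕ} → (∀ a → g a ≡ h a) →
              sum (map g L) ≡ sum (map h L)
sumMap-cong []      eq = refl
sumMap-cong (a ∷ L) eq = cong₂ _+_ (eq a) (sumMap-cong L eq)

sumMap-mono-All : ∀ {A : Set} {Q : A → Set} (L : List A) {g h : A → ℕ} → All Q L →
                  (∀ a → Q a → g a ≤ h a) → sum (map g L) ≤ sum (map h L)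
sumMap-mono-All []      []       le = z≤n
sumMap-mono-All (a ∷ L) (q ∷ qs) le = +-mono-≤ (le a q) (sumMap-mono-All L qs le)

sumMap-mono : ∀ {A : Set} (L : List A) {g h : A → ℕ} → (∀ a → g a ≤ h a) →
              sum (map g L) ≤ sum (map h L)
sumMap-mono L le = sumMap-mono-All L (All.universal (λ _ → tt) L) (λ a _ → le a)

sumMap-const : ∀ {A : Set} (L : List A) k → sum (map (λ _ → k) L) ≡ length L * k
sumMap-const []      k = refl
sumMap-const (a ∷ L) k = cong (k +_) (sumMap-const L k)

sumMap-∑ : ∀ {A : Set} (L : List A) {m} (h : A → Fin m → ℕ) →
           sum (map (λ a → ∑ (h a)) L) ≡ ∑ (λ e → sum (map (λ a → h a e) L))
sumMap-∑ []      {m} h = sym (sum-replicate-zero m)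
sumMap-∑ (a ∷ L)     h = trans (cong (∑ (h a) +_) (sumMap-∑ L h))
                               (sym (∑-distrib-+ (h a) (λ e → sum (map (λ a → h a e) L))))

-- Ratios a/b ≤ c/d are encoded as a * d ≤ c * b; this order is transitive
-- through a middle term with positive denominator.
ratio-trans : ∀ a b c d e g → a * d ≤ c * b → c * g ≤ e * d → 1 ≤ d → a * g ≤ e * b
ratio-trans a b c (suc d) e g ad≤cb cg≤ed _ = *-cancelʳ-≤ (a * g) (e * b) (suc d) (begin
  a * g * suc d   ≡⟨ swap a g (suc d) ⟩
  a * suc d * g   ≤⟨ *-monoˡ-≤ g ad≤cb ⟩
  c * b * g       ≡⟨ swap c b g ⟩
  c * g * b       ≤⟨ *-monoˡ-≤ b cg≤ed ⟩
  e * suc d * b   ≡⟨ swap e (suc d) b ⟩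
  e * b * suc d   ∎)
  where
  open ≤-Reasoning
  swap : ∀ a b c → a * b * c ≡ a * c * b
  swap = solve-∀

RatioMaximiser : (ℕ → ℕ) → ℕ → ℕ → Set
RatioMaximiser g K z = 1 ≤ z × z ≤ K × (∀ z' → 1 ≤ z' → z' ≤ K → g z' * z ≤ g z * z')

-- Every nonempty range 1..K has a ratio maximiser (the witness is chosen
-- uniformly in K, so that it can serve as a total selection function).
ratio-maximiser : (g : ℕ → ℕ) (K : ℕ) → Σ ℕ λ z → 1 ≤ K → RatioMaximiser g K z
ratio-maximiser g zero          = 1 , λ ()
ratio-maximiser g (suc zero)    = 1 , λ _ → ≤-refl , ≤-refl , only-one
  where
  only-one : ∀ z' → 1 ≤ z' → z' ≤ 1 → g z' * 1 ≤ g 1 * z'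
  only-one z' 1≤z' z'≤1 with ≤-antisym z'≤1 1≤z'
  ... | refl = ≤-refl
ratio-maximiser g (suc (suc K)) with ratio-maximiser g (suc K)
... | c , max-c with max-c (s≤s z≤n)
...   | 1≤c , c≤K , c-best with g (suc (suc K)) * c ≤? g c * suc (suc K)
...     | yes last≤c = c , λ _ → 1≤c , m≤n⇒m≤1+n c≤K , keep
  where
  keep : ∀ z' → 1 ≤ z' → z' ≤ suc (suc K) → g z' * c ≤ g c * z'
  keep z' 1≤z' z'≤ with m≤n⇒m<n∨m≡n z'≤
  ... | inj₁ z'<  = c-best z' 1≤z' (s≤s⁻¹ z'<)
  ... | inj₂ refl = last≤c
...     | no last≰c = suc (suc K) , λ _ → s≤s z≤n , ≤-refl , switch
  where
  switch : ∀ z' → 1 ≤ z' → z' ≤ suc (suc K) → g z' * suc (suc K) ≤ g (suc (suc K)) * z'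
  switch z' 1≤z' z'≤ with m≤n⇒m<n∨m≡n z'≤
  ... | inj₁ z'<  = ratio-trans (g z') z' (g c) c (g (suc (suc K))) (suc (suc K))
                      (c-best z' 1≤z' (s≤s⁻¹ z'<)) (<⇒≤ (≰⇒> last≰c)) 1≤c
  ... | inj₂ refl = ≤-refl

ratio-argmax : ∀ k (Q : Fin k → Set) → (∀ e → Dec (Q e)) → (a z : Fin k → ℕ) →
  (∀ e → Q e → 1 ≤ z e) →
  (∀ e → ¬ Q e) ⊎ Σ (Fin k) (λ e → Q e × (∀ e' → Q e' → a e' * z e ≤ a e * z e'))
ratio-argmax zero Q Q? a z pos = inj₁ (λ ())
ratio-argmax (suc k) Q Q? a z pos
  with ratio-argmax k (Q ∘ fsuc) (Q? ∘ fsuc) (a ∘ fsuc) (z ∘ fsuc) (pos ∘ fsuc) | Q? fzero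
... | inj₁ none | yes q₀ = inj₂ (fzero , q₀ , λ { fzero _ → ≤-refl ; (fsuc e) q → contradiction q (none e) })
... | inj₁ none | no ¬q₀ = inj₁ (λ { fzero q → ¬q₀ q ; (fsuc e) q → none e q })
... | inj₂ (e , q , best) | no ¬q₀ =
        inj₂ (fsuc e , q , λ { fzero q' → contradiction q' ¬q₀ ; (fsuc e') q' → best e' q' })
... | inj₂ (e , q , best) | yes q₀ with a fzero * z (fsuc e) ≤? a (fsuc e) * z fzero
...   | yes first≤ = inj₂ (fsuc e , q , λ { fzero _ → first≤ ; (fsuc e') q' → best e' q' })
...   | no first≰  = inj₂ (fzero , q₀ , λ
          { fzero _ → ≤-refl
          ; (fsuc e') q' → ratio-trans (a (fsuc e')) (z (fsuc e')) (a (fsuc e)) (z (fsuc e))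
                             (a fzero) (z fzero) (best e' q') (<⇒≤ (≰⇒> first≰)) (pos (fsuc e) q) })

-- The capped function t ↦ T ⊓ t is concave, hence has diminishing returns:
-- two increments a and s added together gain no more than separately.
cap-submodular : ∀ T W a s → T ⊓ (W + a + s) + T ⊓ W ≤ T ⊓ (W + a) + T ⊓ (W + s)
cap-submodular T W a s with T ≤? W + a | T ≤? W + s
... | yes T≤Wa | _ = begin
  T ⊓ (W + a + s) + T ⊓ W   ≤⟨ +-mono-≤ (m⊓n≤m T _) (⊓-monoʳ-≤ T (m≤m+n W s)) ⟩
  T + T ⊓ (W + s)           ≡⟨ cong (_+ T ⊓ (W + s)) (sym (m≤n⇒m⊓n≡m T≤Wa)) ⟩
  T ⊓ (W + a) + T ⊓ (W + s) ∎
  where open ≤-Reasoning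
... | no _ | yes T≤Ws = begin
  T ⊓ (W + a + s) + T ⊓ W   ≤⟨ +-mono-≤ (m⊓n≤m T _) (⊓-monoʳ-≤ T (m≤m+n W a)) ⟩
  T + T ⊓ (W + a)           ≡⟨ cong (_+ T ⊓ (W + a)) (sym (m≤n⇒m⊓n≡m T≤Ws)) ⟩
  T ⊓ (W + s) + T ⊓ (W + a) ≡⟨ +-comm (T ⊓ (W + s)) _ ⟩
  T ⊓ (W + a) + T ⊓ (W + s) ∎
  where open ≤-Reasoning
... | no T≰Wa | no T≰Ws = begin
  T ⊓ (W + a + s) + T ⊓ W   ≤⟨ +-mono-≤ (m⊓n≤n T _) (m⊓n≤n T W) ⟩
  W + a + s + W             ≡⟨ regroup W a s ⟩
  (W + a) + (W + s)         ≡⟨ sym (cong₂ _+_ (uncapped T≰Wa) (uncapped T≰Ws)) ⟩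
  T ⊓ (W + a) + T ⊓ (W + s) ∎
  where
  open ≤-Reasoning
  uncapped : ∀ {t} → ¬ T ≤ t → T ⊓ t ≡ t
  uncapped T≰t = m≥n⇒m⊓n≡n (<⇒≤ (≰⇒> T≰t))
  regroup : ∀ W a s → W + a + s + W ≡ (W + a) + (W + s)
  regroup = solve-∀

cap-submodular-∑ : ∀ {k} T W (a : Fin k → ℕ) →
  T ⊓ (W + ∑ a) + ∑ {k} (λ _ → T ⊓ W) ≤ T ⊓ W + ∑ (λ e → T ⊓ (W + a e))
cap-submodular-∑ {zero} T W a rewrite +-identityʳ W = ≤-refl
cap-submodular-∑ {suc k} T W a = begin
  T ⊓ (W + (a₀ + A)) + (c + R)   ≡⟨ cong (λ t → T ⊓ t + (c + R)) (sym (+-assoc W a₀ A)) ⟩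
  T ⊓ (W + a₀ + A) + (c + R)     ≡⟨ sym (+-assoc (T ⊓ (W + a₀ + A)) c R) ⟩
  T ⊓ (W + a₀ + A) + c + R       ≤⟨ +-monoˡ-≤ R (cap-submodular T W a₀ A) ⟩
  T ⊓ (W + a₀) + T ⊓ (W + A) + R ≡⟨ +-assoc (T ⊓ (W + a₀)) _ R ⟩
  T ⊓ (W + a₀) + (T ⊓ (W + A) + R) ≤⟨ +-monoʳ-≤ (T ⊓ (W + a₀)) (cap-submodular-∑ T W (a ∘ fsuc)) ⟩
  T ⊓ (W + a₀) + (c + Q)         ≡⟨ swap-front (T ⊓ (W + a₀)) c Q ⟩
  c + (T ⊓ (W + a₀) + Q)         ∎
  where
  open ≤-Reasoning
  a₀ = a fzero
  A = ∑ (a ∘ fsuc)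
  c = T ⊓ W
  R = ∑ {k} (λ _ → c)
  Q = ∑ (λ e → T ⊓ (W + a (fsuc e)))
  swap-front : ∀ x y z → x + (y + z) ≡ y + (x + z)
  swap-front = solve-∀

-- A greedy trace records a run of a greedy algorithm abstractly: a step
-- taken at potential φ + g costs c, lowers the potential by its gain g, and
-- has cost-per-gain at most Y / (φ + g).
data GreedyTrace (Y : ℕ) : ℕ → ℕ → Set where
  stop : ∀ {φ} → GreedyTrace Y φ 0
  step : ∀ {φ g c c'} → 0 < φ + g → c * (φ + g) ≤ g * Y →
         GreedyTrace Y φ c' → GreedyTrace Y (φ + g) (c + c')

-- The phase while the potential lies in [2^B, 2^(B+1)) costs
-- at most 2·Y, since each of its steps pays at most Y / 2^B per unit gain.
greedy-cost : ∀ {Y φ c} B → GreedyTrace Y φ c → φ < 2 ^ B → c ≤ 2 * Y * B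
phase-cost : ∀ {Y φ c} B → GreedyTrace Y φ c → φ < 2 ^ suc B →
             2 ^ B * c ≤ 2 ^ B * (2 * Y * B) + Y * φ

greedy-cost zero    stop           _   = z≤n
greedy-cost zero    (step pos _ _) φ<1 = contradiction (<-≤-trans pos (s≤s⁻¹ φ<1)) (<-irrefl refl)
greedy-cost {Y} {φ} {c} (suc B) trace φ< = *-cancelˡ-≤ (2 ^ B) {{m^n≢0 2 B}} (begin
  2 ^ B * c                           ≤⟨ phase-cost B trace φ< ⟩
  2 ^ B * (2 * Y * B) + Y * φ         ≤⟨ +-monoʳ-≤ (2 ^ B * (2 * Y * B)) (*-monoʳ-≤ Y (<⇒≤ φ<)) ⟩
  2 ^ B * (2 * Y * B) + Y * (2 * 2 ^ B) ≡⟨ collect (2 ^ B) Y B ⟩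
  2 ^ B * (2 * Y * suc B)             ∎)
  where
  open ≤-Reasoning
  collect : ∀ K Y B → K * (2 * Y * B) + Y * (2 * K) ≡ K * (2 * Y * suc B)
  collect = solve-∀

phase-cost B stop _ = ≤-trans (≤-reflexive (*-zeroʳ (2 ^ B))) z≤n
phase-cost {Y} B trace@(step {φ} {g} {c} {c'} _ c-ratio rest) φ< with φ + g <? 2 ^ B
... | yes below = ≤-trans (*-monoʳ-≤ (2 ^ B) (greedy-cost B trace below)) (m≤m+n _ _)
... | no above  = begin
  2 ^ B * (c + c')                            ≡⟨ *-distribˡ-+ (2 ^ B) c c' ⟩
  2 ^ B * c + 2 ^ B * c'                      ≤⟨ +-mono-≤ step-cost (phase-cost B rest (≤-<-trans (m≤m+n φ g) φ<)) ⟩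
  g * Y + (2 ^ B * (2 * Y * B) + Y * φ)       ≡⟨ regroup g Y (2 ^ B * (2 * Y * B)) φ ⟩
  2 ^ B * (2 * Y * B) + Y * (φ + g)           ∎
  where
  open ≤-Reasoning
  step-cost : 2 ^ B * c ≤ g * Y
  step-cost = ≤-trans (≤-trans (*-monoˡ-≤ c (≮⇒≥ above)) (≤-reflexive (*-comm (φ + g) c))) c-ratio
  regroup : ∀ g Y K φ → g * Y + (K + Y * φ) ≡ K + Y * (φ + g)
  regroup = solve-∀

n≤2^⌈log₂n⌉ : ∀ n → n ≤ 2 ^ ⌈log₂ n ⌉
n≤2^⌈log₂n⌉ = <-rec (λ n → n ≤ 2 ^ ⌈log₂ n ⌉) bound
  where
  bound : ∀ n → (∀ {k} → k < n → k ≤ 2 ^ ⌈log₂ k ⌉) → n ≤ 2 ^ ⌈log₂ n ⌉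
  bound zero          _   = z≤n
  bound (suc zero)    _   = s≤s z≤n
  bound n@(suc (suc j)) rec = begin
    n                          ≡⟨ sym (⌊n/2⌋+⌈n/2⌉≡n n) ⟩
    ⌊ n /2⌋ + ⌈ n /2⌉          ≤⟨ +-monoˡ-≤ ⌈ n /2⌉ (⌊n/2⌋≤⌈n/2⌉ n) ⟩
    ⌈ n /2⌉ + ⌈ n /2⌉          ≡⟨ double ⌈ n /2⌉ ⟩
    2 * ⌈ n /2⌉                ≤⟨ *-monoʳ-≤ 2 (rec (s≤s (⌊n/2⌋<n j))) ⟩
    2 ^ suc ⌈log₂ ⌈ n /2⌉ ⌉    ≡⟨ cong (2 ^_) halve ⟩
    2 ^ ⌈log₂ n ⌉              ∎
    where
    open ≤-Reasoning
    double : ∀ c → c + c ≡ 2 * c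
    double = solve-∀
    halve : suc ⌈log₂ ⌈ n /2⌉ ⌉ ≡ ⌈log₂ n ⌉
    halve = trans (cong suc (⌈log₂⌈n/2⌉⌉≡⌈log₂n⌉∸1 n)) (m+[n∸m]≡n (⌈log₂⌉-mono-≤ (s≤s (z≤n {suc j}))))

edges≤n² : ∀ {n m} (src tgt : Fin m → Fin n) →
  ((e e' : Fin m) → src e ≡ src e' → tgt e ≡ tgt e' → e ≡ e') → m ≤ n * n
edges≤n² src tgt endpoints-inj = injective⇒≤ {f = λ e → combine (src e) (tgt e)} λ {e} {e'} same →
  let (same-src , same-tgt) = combine-injective (src e) (tgt e) (src e') (tgt e') same
  in endpoints-inj e e' same-src same-tgt

-- Lists of length ≤ h over Fin m are coded injectively in Fin ((m+1)^h):
-- a list is read as an h-digit number in base m + 1, digit 0 marking the end.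
encode : ∀ {m} h → List (Fin m) → Fin (suc m ^ h)
encode zero    _        = fzero
encode {m} (suc h) []       = combine {suc m} {suc m ^ h} fzero (encode h [])
encode {m} (suc h) (e ∷ es) = combine {suc m} {suc m ^ h} (fsuc e) (encode h es)

encode-injective : ∀ {m} h (xs ys : List (Fin m)) → length xs ≤ h → length ys ≤ h →
                   encode h xs ≡ encode h ys → xs ≡ ys
encode-injective zero    []       []       _ _ _ = refl
encode-injective (suc h) []       []       _ _ _ = refl
encode-injective {m} (suc h) []       (e ∷ es) _ _ eq
  with () ← combine-injectiveˡ {suc m} {suc m ^ h} fzero (encode h []) (fsuc e) (encode h es) eq
encode-injective {m} (suc h) (e ∷ es) []       _ _ eq
  with () ← combine-injectiveˡ {suc m} {suc m ^ h} (fsuc e) (encode h es) fzero (encode h []) eq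
encode-injective {m} (suc h) (e ∷ es) (e' ∷ es') (s≤s ≤h) (s≤s ≤h') eq
  with refl ← combine-injectiveˡ {suc m} {suc m ^ h} (fsuc e) (encode h es) (fsuc e') (encode h es') eq =
  cong (e ∷_) (encode-injective h es es' ≤h ≤h'
                 (combine-injectiveʳ {suc m} {suc m ^ h} (fsuc e) (encode h es) (fsuc e) (encode h es') eq))

lookup-injective : ∀ {A : Set} {L : List A} → Unique L → (i j : Fin (length L)) →
                   lookup L i ≡ lookup L j → i ≡ j
lookup-injective (_     ∷ _)   fzero    fzero    _  = refl
lookup-injective (x∉L ∷ _)     fzero    (fsuc j) eq = contradiction eq (All.lookup x∉L (∈-lookup j))
lookup-injective (x∉L ∷ _)     (fsuc i) fzero    eq = contradiction (sym eq) (All.lookup x∉L (∈-lookup i))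
lookup-injective (_   ∷ uniq)  (fsuc i) (fsuc j) eq = cong fsuc (lookup-injective uniq i j eq)

distinct-short-lists : ∀ {m} h (P : List (List (Fin m))) → Unique P →
                       All (λ p → length p ≤ h) P → length P ≤ suc m ^ h
distinct-short-lists h P uniq short = injective⇒≤ {f = code} code-injective
  where
  code : Fin (length P) → Fin (suc _ ^ h)
  code i = encode h (lookup P i)
  short-at : ∀ i → length (lookup P i) ≤ h
  short-at i = All.lookup short (∈-lookup i)
  code-injective : ∀ {i j} → code i ≡ code j → i ≡ j
  code-injective {i} {j} eq =
    lookup-injective uniq i j (encode-injective h _ _ (short-at i) (short-at j) eq)

D≤|Q|T : ∀ {m} T (f : Weights m) (Q : List (List (Fin m))) x → D T f Q x ≤ length Q * T
D≤|Q|T T f []      x = z≤n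
D≤|Q|T T f (p ∷ Q) x = +-mono-≤ (m⊓n≤m T _) (D≤|Q|T T f Q x)

blocks⇒heavy : ∀ {m} T (f : Weights m) (Q : List (List (Fin m))) x →
               Blocks T f Q x → All (λ p → T ≤ pathWeight f x p) Q
blocks⇒heavy T f []      x _       = []
blocks⇒heavy T f (p ∷ Q) x blocked =
  ≤-trans first-capped (m⊓n≤n T _) ∷ blocks⇒heavy T f Q x rest-blocked
  where
  rest≤ = D≤|Q|T T f Q x
  first-capped : T ≤ T ⊓ pathWeight f x p
  first-capped = +-cancelʳ-≤ (length Q * T) T _
                   (≤-trans (≤-reflexive (sym blocked)) (+-monoʳ-≤ _ rest≤))
  rest-blocked : Blocks T f Q x
  rest-blocked = ≤-antisym rest≤ (+-cancelˡ-≤ T _ _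
                   (≤-trans (≤-reflexive (sym blocked)) (+-monoˡ-≤ _ (m⊓n≤m T _))))

deficit-drop : ∀ n a g → a + g ≤ n → n ∸ (a + g) + g ≡ n ∸ a
deficit-drop n a g a+g≤n = begin
  n ∸ (a + g) + g   ≡⟨ cong (_+ g) (sym (∸-+-assoc n a g)) ⟩
  n ∸ a ∸ g + g     ≡⟨ m∸n+n≡m (m+n≤o⇒m≤o∸n g (subst (_≤ n) (+-comm a g) a+g≤n)) ⟩
  n ∸ a             ∎
  where open ≡-Reasoning

module Objective {m : ℕ} (T : ℕ) (f : Weights m)
  (f-mono : (e : Fin m) (k k' : ℕ) → k ≤ k' → f e k ≤ f e k')
  (P : List (List (Fin m))) where

  N : ℕ
  N = length P * T

  Δ : Budget m → ℕ
  Δ x = N ∸ D T f P x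

  weight : Budget m → List (Fin m) → ℕ
  weight = pathWeight f

  weight-cong : ∀ {x x'} → (∀ e → x e ≡ x' e) → ∀ p → weight x p ≡ weight x' p
  weight-cong eq []      = refl
  weight-cong eq (e ∷ p) = cong₂ _+_ (cong (f e) (eq e)) (weight-cong eq p)

  weight-mono : ∀ {x x'} → x ≤ᵛ x' → ∀ p → weight x p ≤ weight x' p
  weight-mono le []      = z≤n
  weight-mono le (e ∷ p) = +-mono-≤ (f-mono e _ _ (le e)) (weight-mono le p)

  D-cong : ∀ {x x'} → (∀ e → x e ≡ x' e) → D T f P x ≡ D T f P x'
  D-cong eq = sumMap-cong P (λ p → cong (T ⊓_) (weight-cong eq p))

  D-mono : ∀ {x x'} → x ≤ᵛ x' → D T f P x ≤ D T f P x'
  D-mono le = sumMap-mono P (λ p → ⊓-monoʳ-≤ T (weight-mono le p))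

  ≤⊕ : ∀ (x y : Budget m) → x ≤ᵛ (x ⊕ y)
  ≤⊕ x y e = m≤m+n (x e) (y e)

  D-raise : ∀ x e z → D T f P (x ⊕ u e z) ≡ D T f P x + gain T f P x e z
  D-raise x e z = sym (m+[n∸m]≡n (D-mono (≤⊕ x (u e z))))

  gain-zero : ∀ x e → gain T f P x e 0 ≡ 0
  gain-zero x e = trans (cong (_∸ D T f P x) (D-cong unchanged)) (n∸n≡0 (D T f P x))
    where
    unchanged : ∀ i → (x ⊕ u e 0) i ≡ x i
    unchanged i with i ≟ e
    ... | yes _ = +-identityʳ (x i)
    ... | no _  = +-identityʳ (x i)

  -- Per
  -- path, these raises add up to x ⊕ (y ∸ x) ≥ y, which has weight ≥ T; by
  -- diminishing returns of the cap T ⊓ · their separate gains cover T ⊓ ….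
  module Deficit (x y : Budget m) where

    d : Budget m
    d e = y e ∸ x e

    raise : Fin m → Budget m
    raise e = x ⊕ u e (d e)

    -- Along one edge e' of a path, only the raise at e' itself has an effect.
    raise-edge : ∀ e' → ∑ (λ e → f e' (raise e e')) + f e' (x e') ≡
                        f e' (x e' + d e') + ∑ {m} (λ _ → f e' (x e'))
    raise-edge e' = trans (∑-pointwise (λ e → f e' (raise e e')) e' (f e' (x e') ) unaffected)
                          (cong (λ t → f e' (x e' + t) + _) (u-self e' (d e')))
      where
      unaffected : ∀ e → e ≢ e' → f e' (raise e e') ≡ f e' (x e')
      unaffected e e≢e' = cong (f e') (trans (cong (x e' +_) (u-other (d e) (≢-sym e≢e')))
                                             (+-identityʳ (x e')))

    raise-path : ∀ p → ∑ (λ e → weight (raise e) p) + weight x p ≡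
                       weight (x ⊕ d) p + ∑ {m} (λ _ → weight x p)
    raise-path [] = +-identityʳ _
    raise-path (e' ∷ p) = begin
      ∑ (λ e → f e' (raise e e') + weight (raise e) p) + (f e' (x e') + weight x p)
        ≡⟨ cong (_+ (f e' (x e') + weight x p)) (∑-distrib-+ (λ e → f e' (raise e e')) (λ e → weight (raise e) p)) ⟩
      (E + R) + (f e' (x e') + weight x p)
        ≡⟨ interleave E R (f e' (x e')) (weight x p) ⟩
      (E + f e' (x e')) + (R + weight x p)
        ≡⟨ cong₂ _+_ (raise-edge e') (raise-path p) ⟩
      (f e' (x e' + d e') + ∑ {m} (λ _ → f e' (x e'))) + (weight (x ⊕ d) p + ∑ {m} (λ _ → weight x p))
        ≡⟨ interleave (f e' (x e' + d e')) (∑ {m} (λ _ → f e' (x e'))) (weight (x ⊕ d) p) (∑ {m} (λ _ → weight x p)) ⟩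
      (f e' (x e' + d e') + weight (x ⊕ d) p) + (∑ {m} (λ _ → f e' (x e')) + ∑ {m} (λ _ → weight x p))
        ≡⟨ cong (f e' (x e' + d e') + weight (x ⊕ d) p +_) (sym (∑-distrib-+ {m} (λ _ → f e' (x e')) (λ _ → weight x p))) ⟩
      (f e' (x e' + d e') + weight (x ⊕ d) p) + ∑ {m} (λ _ → f e' (x e') + weight x p)
        ∎
      where
      open ≡-Reasoning
      E = ∑ (λ e → f e' (raise e e'))
      R = ∑ (λ e → weight (raise e) p)
      interleave : ∀ a b c d → (a + b) + (c + d) ≡ (a + c) + (b + d)
      interleave = solve-∀

    key-path : ∀ p → T ≤ weight y p →
               T + ∑ {m} (λ _ → r T f x p) ≤ r T f x p + ∑ (λ e → r T f (raise e) p)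
    key-path p heavy = begin
      T + ∑ {m} (λ _ → T ⊓ W)                  ≡⟨ cong (_+ ∑ {m} (λ _ → T ⊓ W)) (sym capped) ⟩
      T ⊓ (W + ∑ a) + ∑ {m} (λ _ → T ⊓ W)      ≤⟨ cap-submodular-∑ T W a ⟩
      T ⊓ W + ∑ (λ e → T ⊓ (W + a e))          ≡⟨ cong (T ⊓ W +_) (sum-cong-≗ (λ e → cong (T ⊓_) (W+a e))) ⟩
      T ⊓ W + ∑ (λ e → r T f (raise e) p)      ∎
      where
      open ≤-Reasoning
      W = weight x p
      a : Fin m → ℕ
      a e = weight (raise e) p ∸ W
      W+a : ∀ e → W + a e ≡ weight (raise e) p
      W+a e = m+[n∸m]≡n (weight-mono (≤⊕ x (u e (d e))) p)
      total : W + ∑ a ≡ weight (x ⊕ d) p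
      total = +-cancelʳ-≡ (∑ {m} (λ _ → W)) _ _ (begin-equality
        W + ∑ a + ∑ {m} (λ _ → W)       ≡⟨ rotate W (∑ a) _ ⟩
        ∑ {m} (λ _ → W) + ∑ a + W       ≡⟨ cong (_+ W) (sym (∑-distrib-+ {m} (λ _ → W) a)) ⟩
        ∑ (λ e → W + a e) + W           ≡⟨ cong (_+ W) (sum-cong-≗ W+a) ⟩
        ∑ (λ e → weight (raise e) p) + W ≡⟨ raise-path p ⟩
        weight (x ⊕ d) p + ∑ {m} (λ _ → W) ∎)
        where
        rotate : ∀ a b c → a + b + c ≡ c + b + a
        rotate = solve-∀
      capped : T ⊓ (W + ∑ a) ≡ T
      capped = m≤n⇒m⊓n≡m (≤-trans heavy (≤-trans (weight-mono (λ e → m≤n+m∸n (y e) (x e)) p)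
                                                 (≤-reflexive (sym total))))

    key-D : All (λ p → T ≤ weight y p) P →
            N + ∑ {m} (λ _ → D T f P x) ≤ D T f P x + ∑ (λ e → D T f P (raise e))
    key-D heavy = begin
      N + ∑ {m} (λ _ → D T f P x)
        ≡⟨ cong₂ _+_ (sym (sumMap-const P T)) (sym (sumMap-∑ P {m} (λ p _ → r T f x p))) ⟩
      sum (map (λ _ → T) P) + sum (map (λ p → ∑ {m} (λ _ → r T f x p)) P)
        ≡⟨ sym (sumMap-+ P (λ _ → T) _) ⟩
      sum (map (λ p → T + ∑ {m} (λ _ → r T f x p)) P)
        ≤⟨ sumMap-mono-All P heavy key-path ⟩
      sum (map (λ p → r T f x p + ∑ (λ e → r T f (raise e) p)) P)
        ≡⟨ sumMap-+ P (r T f x) _ ⟩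
      D T f P x + sum (map (λ p → ∑ (λ e → r T f (raise e) p)) P)
        ≡⟨ cong (D T f P x +_) (sumMap-∑ P (λ p e → r T f (raise e) p)) ⟩
      D T f P x + ∑ (λ e → D T f P (raise e)) ∎
      where open ≤-Reasoning

    deficit≤∑gain : All (λ p → T ≤ weight y p) P → Δ x ≤ ∑ (λ e → gain T f P x e (d e))
    deficit≤∑gain heavy = m≤n+o⇒m∸n≤o N (D T f P x) (+-cancelʳ-≤ (∑ {m} (λ _ → Dx)) N _ (begin
      N + ∑ {m} (λ _ → Dx)                   ≤⟨ key-D heavy ⟩
      Dx + ∑ (λ e → D T f P (raise e))        ≡⟨ cong (Dx +_) (sum-cong-≗ (λ e → D-raise x e (d e))) ⟩
      Dx + ∑ (λ e → Dx + G e)                 ≡⟨ cong (Dx +_) (∑-distrib-+ (λ _ → Dx) G) ⟩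
      Dx + (∑ {m} (λ _ → Dx) + ∑ G)           ≡⟨ swap-last Dx (∑ {m} (λ _ → Dx)) (∑ G) ⟩
      Dx + ∑ G + ∑ {m} (λ _ → Dx)             ∎))
      where
      open ≤-Reasoning
      Dx = D T f P x
      G : Fin m → ℕ
      G e = gain T f P x e (d e)
      swap-last : ∀ a b c → a + (b + c) ≡ a + c + b
      swap-last = solve-∀

module Analysis {m : ℕ} (T : ℕ) (f : Weights m)
  (f-mono : (e : Fin m) (k k' : ℕ) → k ≤ k' → f e k ≤ f e k')
  (P : List (List (Fin m))) (b : Budget m) where

  open Objective T f f-mono P
  open AT T f P b

  amount : ∀ {x x'} → Step x x' → ℕ
  amount (zs , _ , e , lt , _) = zs e lt

  step-gain : ∀ {x x'} → Step x x' → ℕ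
  step-gain {x} (zs , _ , e , lt , _) = gain T f P x e (zs e lt)

  norm-step : ∀ {x x'} (st : Step x x') → norm x' ≡ norm x + amount st
  norm-step {x} {x'} (zs , _ , e , lt , _ , moved) = begin
    norm x'                ≡⟨ norm≡∑ x' ⟩
    ∑ x'                   ≡⟨ sum-cong-≗ moved ⟩
    ∑ (λ i → x i + u e (zs e lt) i) ≡⟨ ∑-distrib-+ x (u e (zs e lt)) ⟩
    ∑ x + ∑ (u e (zs e lt)) ≡⟨ cong₂ _+_ (sym (norm≡∑ x)) (∑-u e (zs e lt)) ⟩
    norm x + zs e lt       ∎
    where open ≡-Reasoning

  D-step : ∀ {x x'} (st : Step x x') → D T f P x' ≡ D T f P x + step-gain st
  D-step {x} (zs , _ , e , lt , _ , moved) = trans (D-cong moved) (D-raise x e (zs e lt))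

  deficit-step : ∀ {x x'} (st : Step x x') → Δ x' + step-gain st ≡ Δ x
  deficit-step {x} {x'} st =
    trans (cong (λ v → N ∸ v + step-gain st) (D-step st))
          (deficit-drop N (D T f P x) (step-gain st) (subst (_≤ N) (D-step st) (D≤|Q|T T f P x')))

  -- The greedy choice pays at most ‖y‖/Δ(x) per unit of gain, for every
  -- y ≤ b blocking P: each edge's raise towards y has ratio at most that of
  -- its best amount z_e, hence at most that of the chosen edge, and these
  -- raises together recover the whole deficit.
  greedy-ratio : ∀ {x x'} (y : Budget m) → y ≤ᵛ b → All (λ p → T ≤ weight y p) P →
                 (st : Step x x') → amount st * Δ x ≤ step-gain st * norm y
  greedy-ratio {x} y y≤b heavy st@(zs , valid , e , lt , best , _) = begin
    z* * Δ x                             ≤⟨ *-monoʳ-≤ z* (deficit≤∑gain heavy) ⟩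
    z* * ∑ (λ e' → gain T f P x e' (d e')) ≡⟨ *-distribˡ-sum z* (λ e' → gain T f P x e' (d e')) ⟩
    ∑ (λ e' → z* * gain T f P x e' (d e')) ≤⟨ ∑-mono per-edge ⟩
    ∑ (λ e' → g* * d e')                 ≡⟨ sym (*-distribˡ-sum g* d) ⟩
    g* * ∑ d                             ≤⟨ *-monoʳ-≤ g* (∑-mono (λ e' → m∸n≤m (y e') (x e'))) ⟩
    g* * ∑ y                             ≡⟨ cong (g* *_) (sym (norm≡∑ y)) ⟩
    g* * norm y                          ∎
    where
    open ≤-Reasoning
    open Deficit x y using (d; deficit≤∑gain)
    z* = amount st
    g* = step-gain st
    per-edge : ∀ e' → z* * gain T f P x e' (d e') ≤ g* * d e'
    per-edge e' with x e' <? y e'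
    ... | yes x<y = let lt' = <-≤-trans x<y (y≤b e') ; (1≤z , _ , z-best) = valid e' lt' in
      subst (_≤ g* * d e') (*-comm (gain T f P x e' (d e')) z*)
        (ratio-trans (gain T f P x e' (d e')) (d e') (gain T f P x e' (zs e' lt')) (zs e' lt') g* z*
          (z-best (d e') (m<n⇒0<n∸m x<y) (∸-monoˡ-≤ (x e') (y≤b e'))) (best e' lt') 1≤z)
    ... | no x≮y rewrite m≤n⇒m∸n≡0 (≮⇒≥ x≮y) | gain-zero x e' =
      ≤-reflexive (trans (*-zeroʳ z*) (sym (*-zeroʳ g*)))

  run-trace : (y : Budget m) → y ≤ᵛ b → All (λ p → T ≤ weight y p) P → ∀ {x z} → Run x z →
              Σ ℕ λ c → GreedyTrace (norm y) (Δ x) c × norm z ≡ norm x + c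
  run-trace y y≤b heavy {x} (done _) = 0 , stop , sym (+-identityʳ (norm x))
  run-trace y y≤b heavy {x} {z} (step {x' = x'} D<N st rest)
    with run-trace y y≤b heavy rest
  ... | c , trace , norm-z = amount st + c , subst (λ φ → GreedyTrace (norm y) φ (amount st + c))
                                                  (deficit-step st) (step positive ratio trace) , (begin
    norm z                    ≡⟨ norm-z ⟩
    norm x' + c               ≡⟨ cong (_+ c) (norm-step st) ⟩
    norm x + amount st + c    ≡⟨ +-assoc (norm x) (amount st) c ⟩
    norm x + (amount st + c)  ∎)
    where
    open ≡-Reasoning
    positive : 0 < Δ x' + step-gain st
    positive = subst (0 <_) (sym (deficit-step st)) (m<n⇒0<n∸m D<N)
    ratio : amount st * (Δ x' + step-gain st) ≤ step-gain st * norm y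
    ratio = subst (λ φ → amount st * φ ≤ step-gain st * norm y) (sym (deficit-step st))
                  (greedy-ratio y y≤b heavy st)

  run-cost : (y : Budget m) → y ≤ᵛ b → Blocks T f P y → ∀ {z} → Run 𝟎 z →
             ∀ B → Δ 𝟎 < 2 ^ B → norm z ≤ 2 * norm y * B
  run-cost y y≤b blocked {z} r B small with run-trace y y≤b (blocks⇒heavy T f P y blocked) r
  ... | c , trace , norm-z = begin
    norm z          ≡⟨ norm-z ⟩
    norm {m} 𝟎 + c  ≡⟨ cong (_+ c) (trans (norm≡∑ {m} 𝟎) (sum-replicate-zero m)) ⟩
    c               ≤⟨ greedy-cost B trace small ⟩
    2 * norm y * B  ∎
    where open ≤-Reasoning

  best-amount : Budget m → Fin m → ℕ
  best-amount x e = proj₁ (ratio-maximiser (gain T f P x e) (b e ∸ x e))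

  best-amount-valid : ∀ x → ValidZSel x (λ e _ → best-amount x e)
  best-amount-valid x e x<b = proj₂ (ratio-maximiser (gain T f P x e) (b e ∸ x e)) (m<n⇒0<n∸m x<b)

  -- While x ≤ b does not block P, AT can make a step that stays in the box:
  -- some edge is unsaturated, since x = b would block P.
  next-step : Blocks T f P b → ∀ x → x ≤ᵛ b → D T f P x < N →
              Σ (Budget m) λ x' → Step x x' × x' ≤ᵛ b
  next-step blocked x x≤b D<N
    with ratio-argmax m (λ e → x e < b e) (λ e → x e <? b e)
           (λ e → gain T f P x e (best-amount x e)) (best-amount x)
           (λ e x<b → proj₁ (best-amount-valid x e x<b))
  ... | inj₁ saturated = contradiction (trans (D-cong x≡b) blocked) (<⇒≢ D<N)
    where
    x≡b : ∀ e → x e ≡ b e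
    x≡b e = ≤-antisym (x≤b e) (≮⇒≥ (saturated e))
  ... | inj₂ (e , x<b , best) =
    x ⊕ u e z , ((λ e _ → best-amount x e) , best-amount-valid x , e , x<b , best , λ _ → refl) , in-box
    where
    z = best-amount x e
    in-box : (x ⊕ u e z) ≤ᵛ b
    in-box i with i ≟ e
    ... | yes refl = ≤-trans (+-monoʳ-≤ (x e) (proj₁ (proj₂ (best-amount-valid x e x<b))))
                             (≤-reflexive (m+[n∸m]≡n (<⇒≤ x<b)))
    ... | no _     = ≤-trans (≤-reflexive (+-identityʳ (x i))) (x≤b i)

  -- Every step strictly lowers the deficit (apply greedy-ratio with y = b).
  step-progress : Blocks T f P b → ∀ {x x'} → D T f P x < N → (st : Step x x') → Δ x' < Δ x
  step-progress blocked {x} {x'} D<N st@(zs , valid , e , x<b , _) = begin-strict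
    Δ x'                  <⟨ m<m+n (Δ x') gain-positive ⟩
    Δ x' + step-gain st   ≡⟨ deficit-step st ⟩
    Δ x                   ∎
    where
    open ≤-Reasoning
    ratio = greedy-ratio b (λ _ → ≤-refl) (blocks⇒heavy T f P b blocked) st
    gain-positive : 0 < step-gain st
    gain-positive with step-gain st | ratio
    ... | zero  | amount*Δ≤0 = contradiction amount*Δ≤0
                                 (<⇒≱ (*-mono-≤ (proj₁ (valid e x<b)) (m<n⇒0<n∸m D<N)))
    ... | suc _ | _          = s≤s z≤n

  run-from : Blocks T f P b → ∀ k x → x ≤ᵛ b → Δ x ≤ k → ∃[ z ] Run x z
  run-from blocked k x x≤b Δ≤k with D T f P x <? N
  ... | no D≮N = x , done (≤-antisym (D≤|Q|T T f P x) (≮⇒≥ D≮N))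
  ... | yes D<N with next-step blocked x x≤b D<N
  ...   | x' , st , x'≤b = continue k Δ≤k
    where
    continue : ∀ k → Δ x ≤ k → ∃[ z ] Run x z
    continue zero    Δ≤0 = contradiction (≤-trans (m<n⇒0<n∸m D<N) Δ≤0) (<-irrefl refl)
    continue (suc k) Δ≤  with run-from blocked k x' x'≤b (s≤s⁻¹ (<-≤-trans (step-progress blocked D<N st) Δ≤))
    ... | z , r = z , step D<N st r

minOver-≤ : ∀ k (g : Fin k → ℕ) e → minOver k g ≤ g e
minOver-≤ (suc zero)    g fzero    = ≤-refl
minOver-≤ (suc (suc k)) g fzero    = m⊓n≤m _ _
minOver-≤ (suc (suc k)) g (fsuc e) = ≤-trans (m⊓n≤n _ _) (minOver-≤ (suc k) (g ∘ fsuc) e)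

minOver-positive : ∀ k (g : Fin (suc k) → ℕ) → (∀ e → 1 ≤ g e) → 1 ≤ minOver (suc k) g
minOver-positive zero    g pos = pos fzero
minOver-positive (suc k) g pos = ⊓-glb (pos fzero) (minOver-positive k (g ∘ fsuc) (pos ∘ fsuc))

≤ceilDiv* : ∀ a k → a ≤ ceilDiv a (suc k) * suc k
≤ceilDiv* a k = +-cancelʳ-≤ k a _ (begin
  a + k                                        ≡⟨ m≡m%n+[m/n]*n (a + k) (suc k) ⟩
  (a + k) % suc k + (a + k) / suc k * suc k    ≤⟨ +-monoˡ-≤ _ (s≤s⁻¹ (m%n<n (a + k) (suc k))) ⟩
  k + (a + k) / suc k * suc k                  ≡⟨ +-comm k _ ⟩
  ceilDiv a (suc k) * suc k + k                ∎)
  where open ≤-Reasoning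

T≤h*w : ∀ {m} T (f : Weights (suc m)) → ((e : Fin (suc m)) (k : ℕ) → 0 < f e k) →
        T ≤ hOf T f * wOf f
T≤h*w {m} T f f-pos with wOf f | minOver-positive m (λ e → f e 0) (λ e → f-pos e 0)
... | suc k | _ = ≤ceilDiv* T k

length*w≤weight : ∀ {m} (f : Weights m) w (p : List (Fin m)) → (∀ e → w ≤ f e 0) →
                  length p * w ≤ pathWeight f 𝟎 p
length*w≤weight f w []      w≤ = z≤n
length*w≤weight f w (e ∷ p) w≤ = +-mono-≤ (w≤ e) (length*w≤weight f w p w≤)

tiny-graph-path : ∀ {n m} (src tgt : Fin m → Fin n) {s t} p → n ≤ 1 → IsPath src tgt s t p → p ≡ []
tiny-graph-path src tgt []      n≤1 _                       = refl
tiny-graph-path src tgt (e ∷ p) n≤1 (_ , ((s≢t ∷ _) ∷ _)) = contradiction (single n≤1 _ _) s≢t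
  where
  single : ∀ {n} → n ≤ 1 → (a a' : Fin n) → a ≡ a'
  single {suc zero}    _          fzero fzero = refl
  single {suc (suc _)} (s≤s ()) _     _

D-empty-paths : ∀ {m} T (f : Weights m) (Q : List (List (Fin m))) x → All (_≡ []) Q → D T f Q x ≡ 0
D-empty-paths T f []       x []           = refl
D-empty-paths T f (.[] ∷ Q) x (refl ∷ empty) =
  trans (cong (T ⊓ 0 +_) (D-empty-paths T f Q x empty)) (trans (+-identityʳ _) (⊓-zeroʳ T))

cube-bound : ∀ A → 2 ≤ A → suc (A * A) ≤ A * A * A
cube-bound A 2≤A = begin
  suc (A * A)       ≤⟨ +-monoˡ-≤ (A * A) (*-mono-≤ 1≤A 1≤A) ⟩
  A * A + A * A     ≡⟨ double (A * A) ⟩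
  A * A * 2         ≤⟨ *-monoʳ-≤ (A * A) 2≤A ⟩
  A * A * A         ∎
  where
  open ≤-Reasoning
  1≤A = ≤-trans (s≤s z≤n) 2≤A
  double : ∀ c → c + c ≡ c * 2
  double = solve-∀

-- A deficit at the zero budget forces a nontrivial instance: T ≥ 1, and at
-- least two vertices (otherwise all paths are empty and D vanishes).
nontrivial : ∀ {n m} (src tgt : Fin m → Fin n) (f : Weights m) (b : Budget m) S T P →
  All (Feasible src tgt S f T) P → Blocks T f P b → D T f P 𝟎 < length P * T → 1 ≤ T × 2 ≤ n
nontrivial {n} src tgt f b S T P feasible blocked D<N = T-positive T D<N , two-vertices
  where
  T-positive : ∀ T → D T f P 𝟎 < length P * T → 1 ≤ T
  T-positive zero    D<0 = contradiction (subst (D zero f P 𝟎 <_) (*-zeroʳ (length P)) D<0) n≮0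
  T-positive (suc _) _   = s≤s z≤n
  two-vertices : 2 ≤ n
  two-vertices with 2 ≤? n
  ... | yes 2≤n = 2≤n
  ... | no 2≰n  = contradiction (subst (D T f P 𝟎 <_) (trans (sym blocked) (D-empty-paths T f P b empty)) D<N) n≮0
    where
    empty : All (_≡ []) P
    empty = All.map (λ ((_ , _ , path) , _) → tiny-graph-path src tgt _ (s≤s⁻¹ (≰⇒> 2≰n)) path) feasible

-- A
-- feasible path has weight < T ≤ h·w, hence fewer than h edges; edges and
-- the end marker give at most n² + 1 ≤ A³ symbols, so there are at most
-- (A³)^h distinct feasible paths; finally T ≤ 2^⌈log₂ T⌉.
instance-size : ∀ n m (src tgt : Fin (suc m) → Fin n) →
  ((e e' : Fin (suc m)) → src e ≡ src e' → tgt e ≡ tgt e' → e ≡ e') →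
  (f : Weights (suc m)) → ((e : Fin (suc m)) (k : ℕ) → 0 < f e k) → ∀ S T P →
  Unique P → All (Feasible src tgt S f T) P → 2 ≤ n →
  length P * T ≤ 2 ^ ((⌈log₂ n ⌉ + ⌈log₂ n ⌉ + ⌈log₂ n ⌉) * hOf T f + ⌈log₂ T ⌉)
instance-size n m src tgt endpoints-inj f f-pos S T P uniq feasible 2≤n = begin
  length P * T                   ≤⟨ *-mono-≤ (distinct-short-lists h P uniq (All.map short feasible)) (n≤2^⌈log₂n⌉ T) ⟩
  suc (suc m) ^ h * 2 ^ LT       ≤⟨ *-monoˡ-≤ (2 ^ LT) (^-monoˡ-≤ h symbols) ⟩
  (A * A * A) ^ h * 2 ^ LT       ≡⟨ cong (λ v → v ^ h * 2 ^ LT) (sym cube) ⟩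
  (2 ^ (L + L + L)) ^ h * 2 ^ LT ≡⟨ cong (_* 2 ^ LT) (^-*-assoc 2 (L + L + L) h) ⟩
  2 ^ ((L + L + L) * h) * 2 ^ LT ≡⟨ sym (^-distribˡ-+-* 2 ((L + L + L) * h) LT) ⟩
  2 ^ ((L + L + L) * h + LT)     ∎
  where
  open ≤-Reasoning
  h = hOf T f
  w = wOf f
  L = ⌈log₂ n ⌉
  LT = ⌈log₂ T ⌉
  A = 2 ^ L
  short : ∀ {p} → Feasible src tgt S f T p → length p ≤ h
  short {p} (_ , light) = <⇒≤ (*-cancelʳ-< w (length p) h
    (≤-<-trans (length*w≤weight f w p (minOver-≤ (suc m) (λ e → f e 0))) (<-≤-trans light (T≤h*w T f f-pos))))
  symbols : suc (suc m) ≤ A * A * A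
  symbols = ≤-trans (s≤s (≤-trans (edges≤n² src tgt endpoints-inj)
                                  (*-mono-≤ (n≤2^⌈log₂n⌉ n) (n≤2^⌈log₂n⌉ n))))
                    (cube-bound A (^-monoʳ-≤ 2 (⌈log₂⌉-mono-≤ 2≤n)))
  cube : 2 ^ (L + L + L) ≡ A * A * A
  cube = trans (^-distribˡ-+-* 2 (L + L) L) (cong (_* A) (^-distribˡ-+-* 2 L L))

bound-arith : ∀ h L LT Y → 1 ≤ h * L → 2 * Y * suc ((L + L + L) * h + LT) ≤ 8 * (h * L + LT) * Y
bound-arith h L LT Y 1≤hL = begin
  2 * Y * suc ((L + L + L) * h + LT) ≤⟨ *-monoʳ-≤ (2 * Y) exponent≤ ⟩
  2 * Y * (4 * (h * L + LT))         ≡⟨ regroup Y (h * L + LT) ⟩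
  8 * (h * L + LT) * Y               ∎
  where
  open ≤-Reasoning
  expand : ∀ h L LT → h * L + ((L + L + L) * h + LT) + 3 * LT ≡ 4 * (h * L + LT)
  expand = solve-∀
  regroup : ∀ Y Q → 2 * Y * (4 * Q) ≡ 8 * Q * Y
  regroup = solve-∀
  exponent≤ : suc ((L + L + L) * h + LT) ≤ 4 * (h * L + LT)
  exponent≤ = ≤-trans (+-monoˡ-≤ _ 1≤hL) (≤-trans (m≤m+n _ (3 * LT)) (≤-reflexive (expand h L LT)))

-- Trivial instances have zero initial deficit and a run of cost 0;
-- otherwise the initial deficit is below 2^(3Lh + LT + 1).
at-approximation : (n m : ℕ) (src tgt : Fin m → Fin n) →
  ((e e' : Fin m) → src e ≡ src e' → tgt e ≡ tgt e' → e ≡ e') →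
  (f : Weights m) → ((e : Fin m) (k : ℕ) → 0 < f e k) →
  ((e : Fin m) (k k' : ℕ) → k ≤ k' → f e k ≤ f e k') →
  (b : Budget m) (S : List (Fin n × Fin n)) (T : ℕ) (P : List (List (Fin m))) →
  Unique P → All (Feasible src tgt S f T) P → Blocks T f P b →
  (x : Budget m) → AT.Run T f P b 𝟎 x → (y : Budget m) → y ≤ᵛ b → Blocks T f P y →
  norm x ≤ 8 * (hOf T f * ⌈log₂ n ⌉ + ⌈log₂ T ⌉) * norm y
at-approximation n zero _ _ _ _ _ _ _ _ _ _ _ _ _ _ _ _ _ _ = z≤n
at-approximation n (suc m) src tgt endpoints-inj f f-pos f-mono b S T P uniq feasible blocked x run y y≤b y-blocks
  with D T f P 𝟎 <? length P * T
... | no D≮N = ≤-trans (≤-trans (run-cost y y≤b y-blocks run 0 no-deficit) (≤-reflexive (*-zeroʳ (2 * norm y)))) z≤n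
  where
  open Objective T f f-mono P using (N; Δ)
  open Analysis T f f-mono P b using (run-cost)
  no-deficit : Δ 𝟎 < 1
  no-deficit = s≤s (≤-reflexive (m≤n⇒m∸n≡0 (≮⇒≥ D≮N)))
... | yes D<N = ≤-trans (run-cost y y≤b y-blocks run (suc B) small-deficit)
                        (bound-arith h L ⌈log₂ T ⌉ (norm y) (*-mono-≤ h-positive L-positive))
  where
  open Objective T f f-mono P using (N; Δ)
  open Analysis T f f-mono P b using (run-cost)
  h = hOf T f
  L = ⌈log₂ n ⌉
  B = (L + L + L) * h + ⌈log₂ T ⌉
  sizes = nontrivial src tgt f b S T P feasible blocked D<N
  L-positive : 1 ≤ L
  L-positive = ⌈log₂⌉-mono-≤ (proj₂ sizes)
  small-deficit : Δ 𝟎 < 2 ^ suc B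
  small-deficit = ≤-<-trans (m∸n≤m N (D T f P 𝟎))
    (≤-<-trans (instance-size n m src tgt endpoints-inj f f-pos S T P uniq feasible (proj₂ sizes))
               (m<m+n (2 ^ B) (≤-trans (m^n>0 2 B) (≤-reflexive (sym (+-identityʳ _))))))
  h-positive : 1 ≤ h
  h-positive with hOf T f | T≤h*w T f f-pos
  ... | zero  | T≤0 = contradiction (≤-trans (proj₁ sizes) T≤0) λ ()
  ... | suc _ | _   = s≤s z≤n

theorem4p5 : ∃[ C ] ((n m : ℕ) (src tgt : Fin m → Fin n) →
    ((e e' : Fin m) → src e ≡ src e' → tgt e ≡ tgt e' → e ≡ e') →
    (f : Weights m) →
    ((e : Fin m) (k : ℕ) → 0 < f e k) →
    ((e : Fin m) (k k' : ℕ) → k ≤ k' → f e k ≤ f e k') →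
    (b : Budget m) (S : List (Fin n × Fin n)) (T : ℕ)
    (P : List (List (Fin m))) →
    Unique P →
    All (Feasible src tgt S f T) P →
    Blocks T f P b →
    (∃[ x ] AT.Run T f P b 𝟎 x) ×
    ((x : Budget m) → AT.Run T f P b 𝟎 x →
    (y : Budget m) → y ≤ᵛ b → Blocks T f P y →
    norm x ≤ C * (hOf T f * ⌈log₂ n ⌉ + ⌈log₂ T ⌉) * norm y))
theorem4p5 = 8 , λ n m src tgt endpoints-inj f f-pos f-mono b S T P uniq feasible blocked →
  Analysis.run-from T f f-mono P b blocked _ 𝟎 (λ _ → z≤n) ≤-refl ,
  at-approximation n m src tgt endpoints-inj f f-pos f-mono b S T P uniq feasible blocked
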